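{- Let $\mathbf{A}'=\langle A,\land,\lor,*,\Rightarrow,0,1\rangle$ be an $\mathcal{S}'$-algebra and set $\neg x:=x\Rightarrow0$. Then $\mathbf{A}=\langle A,\land,\lor,\Rightarrow,\neg,0,1\rangle$ is an $\mathcal{S}$-algebra.
   Context: Nelson's logic $\mathcal S$ is the sentential logic in the language $\langle\land,\lor,\Rightarrow,\neg,0\rangle$ (types $2,2,2,1,0$) given by the following Hilbert-style calculus. Abbreviations: $\phi\Leftrightarrow\psi:=(\phi\Rightarrow\psi)\land(\psi\Rightarrow\phi)$, $1:=\neg 0$, $\phi\Rightarrow^2\psi:=\phi\Rightarrow(\phi\Rightarrow\psi)$; for a finite (possibly empty) list $\Gamma=(\phi_1,\dots,\phi_n)$ of formulas, $\Gamma\Rightarrow\phi:=\phi_1\Rightarrow(\phi_2\Rightarrow(\cdots(\phi_n\Rightarrow\phi)\cdots))$ and $\Gamma\Rightarrow^2\phi:=\phi_1\Rightarrow^2(\phi_2\Rightarrow^2(\cdots(\phi_n\Rightarrow^2\phi)\cdots))$, both being $\phi$ if $\Gamma$ is empty. Axiom schemata: (A1) $\phi\Rightarrow\phi$; (A2) $0\Rightarrow\psi$; (A3) $\neg\phi\Rightarrow(\phi\Rightarrow0)$; (A4) $1$; (A5) $(\phi\Rightarrow\psi)\Leftrightarrow(\neg\psi\Rightarrow\neg\phi)$. Rule schemata (for all formulas and every finite list $\Gamma$), written "premisses / conclusion": (P) $\Gamma\Rightarrow(\phi\Rightarrow(\psi\Rightarrow\gamma))$ / $\Gamma\Rightarrow(\psi\Rightarrow(\phi\Rightarrow\gamma))$;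 (C) $\phi\Rightarrow(\phi\Rightarrow(\phi\Rightarrow\gamma))$ / $\phi\Rightarrow(\phi\Rightarrow\gamma)$; (E) $\Gamma\Rightarrow\phi$, $\phi\Rightarrow\gamma$ / $\Gamma\Rightarrow\gamma$; ($\Rightarrow$l) $\Gamma\Rightarrow\phi$, $\psi\Rightarrow\gamma$ / $\Gamma\Rightarrow((\phi\Rightarrow\psi)\Rightarrow\gamma)$; ($\Rightarrow$r) $\gamma$ / $\phi\Rightarrow\gamma$; ($\land$l1) $\phi\Rightarrow\gamma$ / $(\phi\land\psi)\Rightarrow\gamma$; ($\land$l2) $\psi\Rightarrow\gamma$ / $(\phi\land\psi)\Rightarrow\gamma$; ($\land$r) $\Gamma\Rightarrow\phi$, $\Gamma\Rightarrow\psi$ / $\Gamma\Rightarrow(\phi\land\psi)$; ($\lor$l1) $\phi\Rightarrow\gamma$, $\psi\Rightarrow\gamma$ / $(\phi\lor\psi)\Rightarrow\gamma$; ($\lor$l2) $\phi\Rightarrow^2\gamma$, $\psi\Rightarrow^2\gamma$ / $(\phi\lor\psi)\Rightarrow^2\gamma$; ($\lor$r1) $\Gamma\Rightarrow\phi$ / $\Gamma\Rightarrow(\phi\lor\psi)$; ($\lor$r2) $\Gamma\Rightarrow\psi$ / $\Gamma\Rightarrow(\phi\lor\psi)$; ($\neg\Rightarrow$l) $(\phi\land\neg\psi)\Rightarrow\gamma$ / $\neg(\phi\Rightarrow\psi)\Rightarrow\gamma$; ($\neg\Rightarrow$r) $\Gamma\Rightarrow^2(\phi\land\neg\psi)$ /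 $\Gamma\Rightarrow^2\neg(\phi\Rightarrow\psi)$; ($\neg\land$l) $(\neg\phi\lor\neg\psi)\Rightarrow\gamma$ / $\neg(\phi\land\psi)\Rightarrow\gamma$; ($\neg\land$r) $\Gamma\Rightarrow(\neg\phi\lor\neg\psi)$ / $\Gamma\Rightarrow\neg(\phi\land\psi)$; ($\neg\lor$l) $(\neg\phi\land\neg\psi)\Rightarrow\gamma$ / $\neg(\phi\lor\psi)\Rightarrow\gamma$; ($\neg\lor$r) $\Gamma\Rightarrow(\neg\phi\land\neg\psi)$ / $\Gamma\Rightarrow\neg(\phi\lor\psi)$; ($\neg\neg$l) $\phi\Rightarrow\gamma$ / $\neg\neg\phi\Rightarrow\gamma$; ($\neg\neg$r) $\Gamma\Rightarrow\phi$ / $\Gamma\Rightarrow\neg\neg\phi$. An $\mathcal S$-algebra is an algebra $\langle A,\land,\lor,\Rightarrow,\neg,0,1\rangle$ of type $\langle2,2,2,1,0,0\rangle$ satisfying: (i) $\varphi\approx1$ for every axiom (A1)–(A5) of $\mathcal S$, formulas being read as terms and the abbreviation $1:=\neg0$ of the logic written out (so (A4) gives $\neg0\approx1$); (ii) $x\Rightarrow x\approx1$; (iii) for each rule of $\mathcal S$ with premisses $\varphi_1,\dots,\varphi_n$ and conclusion $\varphi$, the quasi-equation $(\varphi_1\approx1\ \&\cdots\&\ \varphi_n\approx1)\Longrightarrow\varphi\approx1$; (iv) $(x\Rightarrow y\approx1\ \&\ y\Rightarrow x\approx1)\Longrightarrow x\approx y$. A commutative integral residuated lattice (CIRL) is an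 algebra $\langle A,\land,\lor,*,\Rightarrow,1\rangle$ such that $\langle A,\land,\lor\rangle$ is a lattice with top element $1$, $\langle A,*,1\rangle$ is a commutative monoid, and $a*b\le c$ iff $b\le a\Rightarrow c$. A CIBRL is a CIRL with an extra constant $0$ that is the least element; set $\neg a:=a\Rightarrow0$. It is involutive if $\neg\neg x\approx x$, and three-potent if $a*a\le a*a*a$ for all $a$. An $\mathcal S'$-algebra is a three-potent involutive CIBRL $\langle A,\land,\lor,*,\Rightarrow,0,1\rangle$. -}

module Defs where

open import Level using (Level; suc)
open import Data.List using (List; foldr)
open import Data.Product using (_×_)
open import Relation.Binary.PropositionalEquality using (_≡_)

record S'Algebra (ℓ : Level) : Set (suc ℓ) where
  infixr 5 _⇒_
  infixl 7 _*_
  infixr 6 _∧_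
  infixr 6 _∨_
  infix 4 _≤_
  field
    Carrier : Set ℓ
    _∧_ _∨_ _*_ _⇒_ : Carrier → Carrier → Carrier
    𝟘 𝟙 : Carrier
    ∧-comm   : ∀ x y → x ∧ y ≡ y ∧ x
    ∨-comm   : ∀ x y → x ∨ y ≡ y ∨ x
    ∧-assoc  : ∀ x y z → (x ∧ y) ∧ z ≡ x ∧ (y ∧ z)
    ∨-assoc  : ∀ x y z → (x ∨ y) ∨ z ≡ x ∨ (y ∨ z)
    ∧-absorbs-∨ : ∀ x y → x ∧ (x ∨ y) ≡ x
    ∨-absorbs-∧ : ∀ x y → x ∨ (x ∧ y) ≡ x

  _≤_ : Carrier → Carrier → Set ℓ
  x ≤ y = x ∧ y ≡ x

  field
    top : ∀ x → x ≤ 𝟙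
    *-assoc : ∀ x y z → (x * y) * z ≡ x * (y * z)
    *-comm  : ∀ x y → x * y ≡ y * x
    *-identityˡ : ∀ x → 𝟙 * x ≡ x
    residuated₁ : ∀ a b c → a * b ≤ c → b ≤ a ⇒ c
    residuated₂ : ∀ a b c → b ≤ a ⇒ c → a * b ≤ c
    bottom : ∀ x → 𝟘 ≤ x

  ∼ : Carrier → Carrier
  ∼ x = x ⇒ 𝟘

  field
    involutive : ∀ x → ∼ (∼ x) ≡ x
    three-potent : ∀ a → a * a ≤ a * a * a

module SNotation {ℓ : Level} {A : Set ℓ}
  (_∧_ _∨_ _⇒_ : A → A → A) (¬_ : A → A) (𝟘 𝟙 : A) where

  _⇔_ : A → A → A
  x ⇔ y = (x ⇒ y) ∧ (y ⇒ x)

  _⇒²_ : A → A → A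
  x ⇒² y = x ⇒ (x ⇒ y)

  _⇛_ : List A → A → A
  Γ ⇛ x = foldr _⇒_ x Γ

  _⇛²_ : List A → A → A
  Γ ⇛² x = foldr _⇒²_ x Γ

record IsSAlgebra {ℓ : Level} (A : Set ℓ)
  (_∧_ _∨_ _⇒_ : A → A → A) (¬_ : A → A) (𝟘 𝟙 : A) : Set ℓ where
  open SNotation _∧_ _∨_ _⇒_ ¬_ 𝟘 𝟙
  field
    A1 : ∀ φ → φ ⇒ φ ≡ 𝟙
    A2 : ∀ ψ → 𝟘 ⇒ ψ ≡ 𝟙
    A3 : ∀ φ → (¬ φ) ⇒ (φ ⇒ 𝟘) ≡ 𝟙
    A4 : ¬ 𝟘 ≡ 𝟙
    A5 : ∀ φ ψ → (φ ⇒ ψ) ⇔ ((¬ ψ) ⇒ (¬ φ)) ≡ 𝟙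
    refl⇒ : ∀ x → x ⇒ x ≡ 𝟙
    -- (iii) rules as quasi-equations
    rP : ∀ Γ φ ψ γ → Γ ⇛ (φ ⇒ (ψ ⇒ γ)) ≡ 𝟙 → Γ ⇛ (ψ ⇒ (φ ⇒ γ)) ≡ 𝟙
    rC : ∀ φ γ → φ ⇒ (φ ⇒ (φ ⇒ γ)) ≡ 𝟙 → φ ⇒ (φ ⇒ γ) ≡ 𝟙
    rE : ∀ Γ φ γ → Γ ⇛ φ ≡ 𝟙 → φ ⇒ γ ≡ 𝟙 → Γ ⇛ γ ≡ 𝟙
    r⇒l : ∀ Γ φ ψ γ → Γ ⇛ φ ≡ 𝟙 → ψ ⇒ γ ≡ 𝟙 → Γ ⇛ ((φ ⇒ ψ) ⇒ γ) ≡ 𝟙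
    r⇒r : ∀ φ γ → γ ≡ 𝟙 → φ ⇒ γ ≡ 𝟙
    r∧l1 : ∀ φ ψ γ → φ ⇒ γ ≡ 𝟙 → (φ ∧ ψ) ⇒ γ ≡ 𝟙
    r∧l2 : ∀ φ ψ γ → ψ ⇒ γ ≡ 𝟙 → (φ ∧ ψ) ⇒ γ ≡ 𝟙
    r∧r : ∀ Γ φ ψ → Γ ⇛ φ ≡ 𝟙 → Γ ⇛ ψ ≡ 𝟙 → Γ ⇛ (φ ∧ ψ) ≡ 𝟙
    r∨l1 : ∀ φ ψ γ → φ ⇒ γ ≡ 𝟙 → ψ ⇒ γ ≡ 𝟙 → (φ ∨ ψ) ⇒ γ ≡ 𝟙
    r∨l2 : ∀ φ ψ γ → φ ⇒² γ ≡ 𝟙 → ψ ⇒² γ ≡ 𝟙 → (φ ∨ ψ) ⇒² γ ≡ 𝟙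
    r∨r1 : ∀ Γ φ ψ → Γ ⇛ φ ≡ 𝟙 → Γ ⇛ (φ ∨ ψ) ≡ 𝟙
    r∨r2 : ∀ Γ φ ψ → Γ ⇛ ψ ≡ 𝟙 → Γ ⇛ (φ ∨ ψ) ≡ 𝟙
    r¬⇒l : ∀ φ ψ γ → (φ ∧ (¬ ψ)) ⇒ γ ≡ 𝟙 → (¬ (φ ⇒ ψ)) ⇒ γ ≡ 𝟙
    r¬⇒r : ∀ Γ φ ψ → Γ ⇛² (φ ∧ (¬ ψ)) ≡ 𝟙 → Γ ⇛² (¬ (φ ⇒ ψ)) ≡ 𝟙
    r¬∧l : ∀ φ ψ γ → ((¬ φ) ∨ (¬ ψ)) ⇒ γ ≡ 𝟙 → (¬ (φ ∧ ψ)) ⇒ γ ≡ 𝟙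
    r¬∧r : ∀ Γ φ ψ → Γ ⇛ ((¬ φ) ∨ (¬ ψ)) ≡ 𝟙 → Γ ⇛ (¬ (φ ∧ ψ)) ≡ 𝟙
    r¬∨l : ∀ φ ψ γ → ((¬ φ) ∧ (¬ ψ)) ⇒ γ ≡ 𝟙 → (¬ (φ ∨ ψ)) ⇒ γ ≡ 𝟙
    r¬∨r : ∀ Γ φ ψ → Γ ⇛ ((¬ φ) ∧ (¬ ψ)) ≡ 𝟙 → Γ ⇛ (¬ (φ ∨ ψ)) ≡ 𝟙
    r¬¬l : ∀ φ γ → φ ⇒ γ ≡ 𝟙 → (¬ (¬ φ)) ⇒ γ ≡ 𝟙
    r¬¬r : ∀ Γ φ → Γ ⇛ φ ≡ 𝟙 → Γ ⇛ (¬ (¬ φ)) ≡ 𝟙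
    antisym : ∀ x y → x ⇒ y ≡ 𝟙 → y ⇒ x ≡ 𝟙 → x ≡ y

module Submission where

-- The whole proof rests on the residuation bridge  x ⇒ y ≡ 𝟙  iff  x ≤ y,
-- which turns each axiom into an inequality and each rule into a
-- monotonicity statement.

open import Level using (Level)
open import Data.List using (List; []; _∷_)
open import Data.Product using (_,_)
open import Relation.Binary.PropositionalEquality
open import Relation.Binary.Bundles using (Poset)
open import Algebra.Bundles using (CommutativeSemigroup)
open import Algebra.Lattice.Bundles using (Lattice)
import Algebra.Properties.CommutativeSemigroup as CommutativeSemigroupProperties
import Algebra.Lattice.Properties.Lattice as LatticeProperties
import Relation.Binary.Lattice as OrderTheoretic
import Relation.Binary.Reasoning.PartialOrder as PosetReasoning
open import Defs

module S'AlgebraProperties {ℓ : Level} (A' : S'Algebra ℓ) where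
  open S'Algebra A'
  open SNotation _∧_ _∨_ _⇒_ ∼ 𝟘 𝟙

  ∧∨-lattice : Lattice ℓ ℓ
  ∧∨-lattice = record
    { Carrier   = Carrier
    ; _≈_       = _≡_
    ; _∨_       = _∨_
    ; _∧_       = _∧_
    ; isLattice = record
      { isEquivalence = isEquivalence
      ; ∨-comm        = ∨-comm
      ; ∨-assoc       = ∨-assoc
      ; ∨-cong        = cong₂ _∨_
      ; ∧-comm        = ∧-comm
      ; ∧-assoc       = ∧-assoc
      ; ∧-cong        = cong₂ _∧_
      ; absorptive    = ∨-absorbs-∧ , ∧-absorbs-∨
      }
    }

  -- The library orders it by  x ≡ x ∧ y,  which is our  x ∧ y ≡ x  reversed.
  private
    module Lib = OrderTheoretic.Lattice
      (LatticeProperties.∨-∧-orderTheoreticLattice ∧∨-lattice)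

  ≤-reflexive : ∀ {x y} → x ≡ y → x ≤ y
  ≤-reflexive e = sym (Lib.reflexive e)

  ≤-refl : ∀ {x} → x ≤ x
  ≤-refl = ≤-reflexive refl

  ≤-trans : ∀ {x y z} → x ≤ y → y ≤ z → x ≤ z
  ≤-trans p q = sym (Lib.trans (sym p) (sym q))

  ≤-antisym : ∀ {x y} → x ≤ y → y ≤ x → x ≡ y
  ≤-antisym p q = Lib.antisym (sym p) (sym q)

  ≤-poset : Poset ℓ ℓ ℓ
  ≤-poset = record
    { _≤_            = _≤_
    ; isPartialOrder = record
      { isPreorder = record
        { isEquivalence = isEquivalence
        ; reflexive     = ≤-reflexive
        ; trans         = ≤-trans
        }
      ; antisym = ≤-antisym
      }
    }

  ∧-lowerˡ : ∀ x y → x ∧ y ≤ x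
  ∧-lowerˡ x y = sym (Lib.x∧y≤x x y)

  ∧-lowerʳ : ∀ x y → x ∧ y ≤ y
  ∧-lowerʳ x y = sym (Lib.x∧y≤y x y)

  ∧-greatest : ∀ {x y z} → z ≤ x → z ≤ y → z ≤ x ∧ y
  ∧-greatest p q = sym (Lib.∧-greatest (sym p) (sym q))

  ∨-upperˡ : ∀ x y → x ≤ x ∨ y
  ∨-upperˡ x y = sym (Lib.x≤x∨y x y)

  ∨-upperʳ : ∀ x y → y ≤ x ∨ y
  ∨-upperʳ x y = sym (Lib.y≤x∨y x y)

  ∨-least : ∀ {x y z} → x ≤ z → y ≤ z → x ∨ y ≤ z
  ∨-least p q = sym (Lib.∨-least (sym p) (sym q))

  𝟙≤→≡𝟙 : ∀ {x} → 𝟙 ≤ x → x ≡ 𝟙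
  𝟙≤→≡𝟙 {x} = ≤-antisym (top x)

  *-commutativeSemigroup : CommutativeSemigroup ℓ ℓ
  *-commutativeSemigroup = record
    { Carrier                = Carrier
    ; _≈_                    = _≡_
    ; _∙_                    = _*_
    ; isCommutativeSemigroup = record
      { isSemigroup = record
        { isMagma = record { isEquivalence = isEquivalence ; ∙-cong = cong₂ _*_ }
        ; assoc   = *-assoc
        }
      ; comm = *-comm
      }
    }

  open CommutativeSemigroupProperties *-commutativeSemigroup
    using (interchange) renaming (x∙yz≈y∙xz to *-swap)

  *-identityʳ : ∀ x → x * 𝟙 ≡ x
  *-identityʳ x = trans (*-comm x 𝟙) (*-identityˡ x)

  -- The square of a product, as it arises from a double residual a ⇒ (a ⇒ _).
  square-of-product : ∀ a d → a * (a * (d * d)) ≡ (a * d) * (a * d)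
  square-of-product a d = trans (sym (*-assoc a a (d * d))) (interchange a a d d)

  ≤→⇒≡𝟙 : ∀ {x y} → x ≤ y → x ⇒ y ≡ 𝟙
  ≤→⇒≡𝟙 {x} {y} p = 𝟙≤→≡𝟙 (residuated₁ x 𝟙 y (subst (_≤ y) (sym (*-identityʳ x)) p))

  ⇒≡𝟙→≤ : ∀ {x y} → x ⇒ y ≡ 𝟙 → x ≤ y
  ⇒≡𝟙→≤ {x} {y} e =
    subst (_≤ y) (*-identityʳ x) (residuated₂ x 𝟙 y (≤-reflexive (sym e)))

  ⇒⇒≡𝟙→≤ : ∀ {a b c} → a ⇒ (b ⇒ c) ≡ 𝟙 → b * a ≤ c
  ⇒⇒≡𝟙→≤ {a} {b} {c} e = residuated₂ b a c (⇒≡𝟙→≤ e)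

  ≤→⇒⇒≡𝟙 : ∀ {a b c} → b * a ≤ c → a ⇒ (b ⇒ c) ≡ 𝟙
  ≤→⇒⇒≡𝟙 {a} {b} {c} p = ≤→⇒≡𝟙 (residuated₁ b a c p)

  modus-ponens : ∀ a c → a * (a ⇒ c) ≤ c
  modus-ponens a c = residuated₂ a (a ⇒ c) c ≤-refl

  *-monoʳ : ∀ a {b b'} → b ≤ b' → a * b ≤ a * b'
  *-monoʳ a {b' = b'} p = residuated₂ a _ _ (≤-trans p (residuated₁ a b' _ ≤-refl))

  *-mono : ∀ {a a' b b'} → a ≤ a' → b ≤ b' → a * b ≤ a' * b'
  *-mono {a} {a'} {b} {b'} p q = begin
    a * b    ≡⟨ *-comm a b ⟩
    b * a    ≤⟨ *-monoʳ b p ⟩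
    b * a'   ≡⟨ *-comm b a' ⟩
    a' * b   ≤⟨ *-monoʳ a' q ⟩
    a' * b'  ∎
    where open PosetReasoning ≤-poset

  -- Integrality (𝟙 is the top and the unit): products shrink.
  integral : ∀ a b → a * b ≤ a
  integral a b = residuated₂ a b a (≤-trans (top b) (residuated₁ a 𝟙 a (≤-reflexive (*-identityʳ a))))

  *≤∧ : ∀ a b → a * b ≤ a ∧ b
  *≤∧ a b = ∧-greatest (integral a b) (subst (_≤ b) (*-comm b a) (integral b a))

  ∨-*-least : ∀ {a b c m} → a * c ≤ m → b * c ≤ m → (a ∨ b) * c ≤ m
  ∨-*-least {a} {b} {c} {m} p q = subst (_≤ m) (*-comm c (a ∨ b))
    (residuated₂ c _ m (∨-least (flip p) (flip q)))
    where
    flip : ∀ {u} → u * c ≤ m → u ≤ c ⇒ m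
    flip {u} r = residuated₁ c u m (subst (_≤ m) (*-comm u c) r)

  ⇒-monoʳ : ∀ a {x y} → x ≤ y → a ⇒ x ≤ a ⇒ y
  ⇒-monoʳ a {x} p = residuated₁ a _ _ (≤-trans (modus-ponens a x) p)

  ⇒-∧ : ∀ a x y → (a ⇒ x) ∧ (a ⇒ y) ≤ a ⇒ (x ∧ y)
  ⇒-∧ a x y = residuated₁ a _ _ (∧-greatest (below x (∧-lowerˡ _ _)) (below y (∧-lowerʳ _ _)))
    where
    below : ∀ z → (a ⇒ x) ∧ (a ⇒ y) ≤ a ⇒ z → a * ((a ⇒ x) ∧ (a ⇒ y)) ≤ z
    below z = residuated₂ a _ z

  -- Rule (⇒l): from ψ ≤ γ, modus ponens gives φ ≤ (φ ⇒ ψ) ⇒ γ.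
  below-residual-of-residual : ∀ {φ ψ γ} → ψ ≤ γ → φ ≤ (φ ⇒ ψ) ⇒ γ
  below-residual-of-residual {φ} {ψ} {γ} p = residuated₁ (φ ⇒ ψ) φ γ
    (subst (_≤ γ) (*-comm φ (φ ⇒ ψ)) (≤-trans (modus-ponens φ ψ) p))

  indirect-≡ : ∀ {x y} → (∀ {z} → z ≤ x → z ≤ y) → (∀ {z} → z ≤ y → z ≤ x) → x ≡ y
  indirect-≡ f g = ≤-antisym (f ≤-refl) (g ≤-refl)

  ⇒-curry : ∀ a b c → (a * b) ⇒ c ≡ b ⇒ (a ⇒ c)
  ⇒-curry a b c = indirect-≡ curry uncurry
    where
    curry : ∀ {z} → z ≤ (a * b) ⇒ c → z ≤ b ⇒ (a ⇒ c)
    curry {z} p = residuated₁ b z _ (residuated₁ a _ c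
      (subst (_≤ c) (*-assoc a b z) (residuated₂ (a * b) z c p)))
    uncurry : ∀ {z} → z ≤ b ⇒ (a ⇒ c) → z ≤ (a * b) ⇒ c
    uncurry {z} p = residuated₁ (a * b) z c
      (subst (_≤ c) (sym (*-assoc a b z)) (residuated₂ a _ c (residuated₂ b z _ p)))

  -- Exchange of premisses, the algebraic content of rule (P).
  ⇒-exchange : ∀ a b c → a ⇒ (b ⇒ c) ≡ b ⇒ (a ⇒ c)
  ⇒-exchange a b c = begin
    a ⇒ (b ⇒ c)  ≡⟨ ⇒-curry b a c ⟨
    (b * a) ⇒ c  ≡⟨ cong (_⇒ c) (*-comm b a) ⟩
    (a * b) ⇒ c  ≡⟨ ⇒-curry a b c ⟩
    b ⇒ (a ⇒ c)  ∎
    where open ≡-Reasoning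

  contraposition : ∀ a b → ∼ b ⇒ ∼ a ≡ a ⇒ b
  contraposition a b = begin
    ∼ b ⇒ (a ⇒ 𝟘)  ≡⟨ ⇒-exchange (∼ b) a 𝟘 ⟩
    a ⇒ ∼ (∼ b)    ≡⟨ cong (a ⇒_) (involutive b) ⟩
    a ⇒ b          ∎
    where open ≡-Reasoning

  ∼-antitone : ∀ {a b} → a ≤ b → ∼ b ≤ ∼ a
  ∼-antitone {a} {b} p = ⇒≡𝟙→≤ (trans (contraposition a b) (≤→⇒≡𝟙 p))

  ∼-flip : ∀ {a b} → a ≤ ∼ b → b ≤ ∼ a
  ∼-flip {a} {b} p = subst (_≤ ∼ a) (involutive b) (∼-antitone p)

  ∼-⇒ : ∀ a b → ∼ (a ⇒ b) ≡ a * ∼ b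
  ∼-⇒ a b = begin
    ∼ (a ⇒ b)              ≡⟨ cong ∼ residual-as-negation ⟨
    ∼ (∼ (a * ∼ b))        ≡⟨ involutive (a * ∼ b) ⟩
    a * ∼ b                ∎
    where
    open ≡-Reasoning
    residual-as-negation : ∼ (a * ∼ b) ≡ a ⇒ b
    residual-as-negation = trans (⇒-curry a (∼ b) 𝟘) (contraposition a b)

  ∼-⇒-≤-∧ : ∀ a b → ∼ (a ⇒ b) ≤ a ∧ ∼ b
  ∼-⇒-≤-∧ a b = subst (_≤ a ∧ ∼ b) (sym (∼-⇒ a b)) (*≤∧ a (∼ b))

  ∼-∨ : ∀ x y → ∼ (x ∨ y) ≡ ∼ x ∧ ∼ y
  ∼-∨ x y = ≤-antisym
    (∧-greatest (∼-antitone (∨-upperˡ x y)) (∼-antitone (∨-upperʳ x y)))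
    (∼-flip (∨-least (∼-flip (∧-lowerˡ (∼ x) (∼ y))) (∼-flip (∧-lowerʳ (∼ x) (∼ y)))))

  ∼-∧ : ∀ x y → ∼ (x ∧ y) ≡ ∼ x ∨ ∼ y
  ∼-∧ x y = begin
    ∼ (x ∧ y)                  ≡⟨ cong ∼ (cong₂ _∧_ (involutive x) (involutive y)) ⟨
    ∼ (∼ (∼ x) ∧ ∼ (∼ y))      ≡⟨ cong ∼ (∼-∨ (∼ x) (∼ y)) ⟨
    ∼ (∼ (∼ x ∨ ∼ y))          ≡⟨ involutive (∼ x ∨ ∼ y) ⟩
    ∼ x ∨ ∼ y                  ∎
    where open ≡-Reasoning

  ⇛-mono : ∀ Γ {x y} → x ≤ y → Γ ⇛ x ≤ Γ ⇛ y
  ⇛-mono []      p = p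
  ⇛-mono (a ∷ Γ) p = ⇒-monoʳ a (⇛-mono Γ p)

  ⇛-∧ : ∀ Γ x y → (Γ ⇛ x) ∧ (Γ ⇛ y) ≤ Γ ⇛ (x ∧ y)
  ⇛-∧ []      x y = ≤-refl
  ⇛-∧ (a ∷ Γ) x y = ≤-trans (⇒-∧ a _ _) (⇒-monoʳ a (⇛-∧ Γ x y))

  -- Validity in context is inherited upwards: the common core of the rules
  -- (E), (⇒l), (∨r), (¬∧r), (¬∨r).
  ⇛-valid-mono : ∀ Γ {x y} → x ≤ y → Γ ⇛ x ≡ 𝟙 → Γ ⇛ y ≡ 𝟙
  ⇛-valid-mono Γ p e = 𝟙≤→≡𝟙 (≤-trans (≤-reflexive (sym e)) (⇛-mono Γ p))

  -- x ≼² y: every square below x is below y.  Under Γ ⇛² _ the premisses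
  -- are squared, so this (not ≤) is the order that Γ ⇛² _ preserves.
  _≼²_ : Carrier → Carrier → Set ℓ
  x ≼² y = ∀ d → d * d ≤ x → d * d ≤ y

  -- a ⇒² _ preserves ≼², since squares under a ⇒² _ are squares of a * d.
  ⇒²-mono : ∀ a {x y} → x ≼² y → (a ⇒² x) ≼² (a ⇒² y)
  ⇒²-mono a {x} {y} x≼²y d p =
    residuated₁ a _ _ (residuated₁ a _ _ (subst (_≤ y) (sym (square-of-product a d))
      (x≼²y (a * d) (subst (_≤ x) (square-of-product a d)
        (residuated₂ a _ x (residuated₂ a _ _ p))))))

  ⇛²-mono : ∀ Γ {x y} → x ≼² y → (Γ ⇛² x) ≼² (Γ ⇛² y)
  ⇛²-mono []      p = p
  ⇛²-mono (a ∷ Γ) p = ⇒²-mono a (⇛²-mono Γ p)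

  -- Validity transfers along ≼², taking d = 𝟙.
  ≼²-valid : ∀ {x y} → x ≼² y → x ≡ 𝟙 → y ≡ 𝟙
  ≼²-valid {x} p e = 𝟙≤→≡𝟙 (subst (_≤ _) (*-identityʳ 𝟙)
    (p 𝟙 (subst (_≤ x) (sym (*-identityʳ 𝟙)) (≤-reflexive (sym e)))))

  -- Three-potence, in the bracketing produced by a ⇒ (a ⇒ (a ⇒ _)).
  three-potent-assoc : ∀ a → a * a ≤ a * (a * a)
  three-potent-assoc a = subst (a * a ≤_) (*-assoc a a a) (three-potent a)

  square-idempotent : ∀ d → d * d ≤ (d * d) * (d * d)
  square-idempotent d = begin
    d * d              ≤⟨ three-potent d ⟩
    (d * d) * d        ≤⟨ *-mono (three-potent d) ≤-refl ⟩
    ((d * d) * d) * d  ≡⟨ *-assoc (d * d) d d ⟩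
    (d * d) * (d * d)  ∎
    where open PosetReasoning ≤-poset

  repeat-front : ∀ a b → a * (a * b) ≤ a * a
  repeat-front a b = subst (_≤ a * a) (*-assoc a a b) (integral (a * a) b)

  repeat-ends : ∀ a b → a * (b * a) ≤ a * a
  repeat-ends a b = subst (_≤ a * a) (cong (a *_) (*-comm a b)) (repeat-front a b)

  repeat-back : ∀ a b → b * (a * a) ≤ a * a
  repeat-back a b = subst (_≤ a * a) (*-comm (a * a) b) (integral (a * a) b)

  data OneOf (x y : Carrier) : Carrier → Set ℓ where
    left  : OneOf x y x
    right : OneOf x y y

  -- Three factors from {x, y} repeat one of them (pigeonhole).
  triple-below : ∀ {x y m} → x * x ≤ m → y * y ≤ m →
    ∀ {u v w} → OneOf x y u → OneOf x y v → OneOf x y w → u * (v * w) ≤ m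
  triple-below {x} {y} {m} hx hy = triple
    where
    triple : ∀ {u v w} → OneOf x y u → OneOf x y v → OneOf x y w → u * (v * w) ≤ m
    triple left  left  left  = ≤-trans (repeat-front x x) hx
    triple left  left  right = ≤-trans (repeat-front x y) hx
    triple left  right left  = ≤-trans (repeat-ends x y) hx
    triple left  right right = ≤-trans (repeat-back y x) hy
    triple right left  left  = ≤-trans (repeat-back x y) hx
    triple right left  right = ≤-trans (repeat-ends y x) hy
    triple right right left  = ≤-trans (repeat-front y x) hy
    triple right right right = ≤-trans (repeat-front y y) hy

  -- Expanding (x ∨ y)³ by distributivity: it is below m once all eight
  -- products of three factors from {x, y} are.
  join-cube-below : ∀ {x y m} →
    (∀ {u v w} → OneOf x y u → OneOf x y v → OneOf x y w → u * (v * w) ≤ m) →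
    (x ∨ y) * ((x ∨ y) * (x ∨ y)) ≤ m
  join-cube-below {x} {y} {m} h =
    expand λ u → subst (_≤ m) (sym (*-swap _ s s))
      (expand λ v → subst (_≤ m) (sym swap-in)
        (expand λ w → h w v u))
    where
    s = x ∨ y
    expand : ∀ {c} → (∀ {u} → OneOf x y u → u * c ≤ m) → s * c ≤ m
    expand g = ∨-*-least (g left) (g right)
    swap-in : ∀ {u v} → v * (u * s) ≡ s * (v * u)
    swap-in {u} {v} = trans (cong (v *_) (*-comm u s)) (*-swap v s u)

  join-square-below : ∀ {x y m} → x * x ≤ m → y * y ≤ m → (x ∨ y) * (x ∨ y) ≤ m
  join-square-below {x} {y} hx hy =
    ≤-trans (three-potent-assoc (x ∨ y)) (join-cube-below (triple-below hx hy))

  -- Rule (¬⇒r): squares below φ ∧ ∼ ψ lie below φ * ∼ ψ ≡ ∼ (φ ⇒ ψ).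
  meet-≼²-negated-residual : ∀ φ ψ → (φ ∧ ∼ ψ) ≼² ∼ (φ ⇒ ψ)
  meet-≼²-negated-residual φ ψ d p = begin
    d * d              ≤⟨ square-idempotent d ⟩
    (d * d) * (d * d)  ≤⟨ *-mono (≤-trans p (∧-lowerˡ φ (∼ ψ))) (≤-trans p (∧-lowerʳ φ (∼ ψ))) ⟩
    φ * ∼ ψ            ≡⟨ ∼-⇒ φ ψ ⟨
    ∼ (φ ⇒ ψ)          ∎
    where open PosetReasoning ≤-poset

  isSAlgebra : IsSAlgebra Carrier _∧_ _∨_ _⇒_ ∼ 𝟘 𝟙
  isSAlgebra = record
    { A1      = λ φ → ≤→⇒≡𝟙 ≤-refl
    ; A2      = λ ψ → ≤→⇒≡𝟙 (bottom ψ)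
    ; A3      = λ φ → ≤→⇒≡𝟙 ≤-refl
    ; A4      = ≤→⇒≡𝟙 ≤-refl
    ; A5      = λ φ ψ → trans (cong₂ _∧_
                  (≤→⇒≡𝟙 (≤-reflexive (sym (contraposition φ ψ))))
                  (≤→⇒≡𝟙 (≤-reflexive (contraposition φ ψ)))) (top 𝟙)
    ; refl⇒   = λ x → ≤→⇒≡𝟙 ≤-refl
    ; rP      = λ Γ φ ψ γ → subst (λ z → Γ ⇛ z ≡ 𝟙) (⇒-exchange φ ψ γ)
    ; rC      = λ φ γ e → ≤→⇒⇒≡𝟙 (≤-trans (three-potent-assoc φ)
                  (residuated₂ φ _ γ (⇒⇒≡𝟙→≤ e)))
    ; rE      = λ Γ φ γ p q → ⇛-valid-mono Γ (⇒≡𝟙→≤ q) p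
    ; r⇒l     = λ Γ φ ψ γ p q → ⇛-valid-mono Γ (below-residual-of-residual (⇒≡𝟙→≤ q)) p
    ; r⇒r     = λ φ γ e → ≤→⇒≡𝟙 (subst (φ ≤_) (sym e) (top φ))
    ; r∧l1    = λ φ ψ γ p → ≤→⇒≡𝟙 (≤-trans (∧-lowerˡ φ ψ) (⇒≡𝟙→≤ p))
    ; r∧l2    = λ φ ψ γ p → ≤→⇒≡𝟙 (≤-trans (∧-lowerʳ φ ψ) (⇒≡𝟙→≤ p))
    ; r∧r     = λ Γ φ ψ p q → 𝟙≤→≡𝟙 (≤-trans
                  (∧-greatest (≤-reflexive (sym p)) (≤-reflexive (sym q))) (⇛-∧ Γ φ ψ))
    ; r∨l1    = λ φ ψ γ p q → ≤→⇒≡𝟙 (∨-least (⇒≡𝟙→≤ p) (⇒≡𝟙→≤ q))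
    ; r∨l2    = λ φ ψ γ p q → ≤→⇒⇒≡𝟙 (join-square-below (⇒⇒≡𝟙→≤ p) (⇒⇒≡𝟙→≤ q))
    ; r∨r1    = λ Γ φ ψ → ⇛-valid-mono Γ (∨-upperˡ φ ψ)
    ; r∨r2    = λ Γ φ ψ → ⇛-valid-mono Γ (∨-upperʳ φ ψ)
    ; r¬⇒l    = λ φ ψ γ p → ≤→⇒≡𝟙 (≤-trans (∼-⇒-≤-∧ φ ψ) (⇒≡𝟙→≤ p))
    ; r¬⇒r    = λ Γ φ ψ → ≼²-valid (⇛²-mono Γ (meet-≼²-negated-residual φ ψ))
    ; r¬∧l    = λ φ ψ γ → subst (λ z → z ⇒ γ ≡ 𝟙) (sym (∼-∧ φ ψ))
    ; r¬∧r    = λ Γ φ ψ → subst (λ z → Γ ⇛ z ≡ 𝟙) (sym (∼-∧ φ ψ))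
    ; r¬∨l    = λ φ ψ γ → subst (λ z → z ⇒ γ ≡ 𝟙) (sym (∼-∨ φ ψ))
    ; r¬∨r    = λ Γ φ ψ → subst (λ z → Γ ⇛ z ≡ 𝟙) (sym (∼-∨ φ ψ))
    ; r¬¬l    = λ φ γ → subst (λ z → z ⇒ γ ≡ 𝟙) (sym (involutive φ))
    ; r¬¬r    = λ Γ φ → subst (λ z → Γ ⇛ z ≡ 𝟙) (sym (involutive φ))
    ; antisym = λ x y p q → ≤-antisym (⇒≡𝟙→≤ p) (⇒≡𝟙→≤ q)
    }

proposition3p9 : ∀ {ℓ : Level} (A' : S'Algebra ℓ) →
    IsSAlgebra (S'Algebra.Carrier A') (S'Algebra._∧_ A') (S'Algebra._∨_ A')
      (S'Algebra._⇒_ A') (S'Algebra.∼ A') (S'Algebra.𝟘 A') (S'Algebra.𝟙 A')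
proposition3p9 A' = S'AlgebraProperties.isSAlgebra A'
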